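{- For any set $S$, the cycle graph $C_4$ is not a sum graph over the magma $(\mathcal{P}(S),\overline{\cap})$, where $A\,\overline{\cap}\,B=\overline{A\cap B}=S\setminus(A\cap B)$ for $A,B\subseteq S$.
   Context: Given a magma $(M,\oplus)$ and a finite subset $V\subseteq M$, $\mathcal{G}_M(V)$ denotes the simple graph with vertex set $V$ in which two distinct vertices $v,w$ are adjacent if and only if $v\oplus w\in V$ or $w\oplus v\in V$. A graph $G$ is a sum graph over $M$ if $G$ is isomorphic to $\mathcal{G}_M(V)$ for some $V\subseteq M$. $C_4$ is the cycle graph on 4 vertices. -}

module Defs where

open import Level using (0ℓ)
open import Data.Nat using (ℕ)
open import Data.Fin using (Fin; zero; suc)
open import Data.Bool using (Bool; not; _∧_)
open import Data.Product using (∃; _×_; _,_)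
open import Data.Sum using (_⊎_)
open import Data.Unit using (⊤)
open import Data.Empty using (⊥)
open import Relation.Nullary using (¬_)
open import Relation.Binary.PropositionalEquality
  using (_≡_; _≢_; refl; _≗_; cong₂; trans; sym)
open import Algebra.Bundles using (Magma)
open import Function.Bundles using (_⤖_; _⇔_; Bijection)

record Graph (n : ℕ) : Set₁ where
  field
    Adj : Fin n → Fin n → Set

open Graph public

record _≅G_ {n m : ℕ} (G : Graph n) (H : Graph m) : Set where
  field
    bij : Fin n ⤖ Fin m
    adj⇔ : ∀ i j → Adj G i j ⇔ Adj H (Bijection.to bij i) (Bijection.to bij j)

C4Adj : Fin 4 → Fin 4 → Set
C4Adj zero (suc zero) = ⊤
C4Adj (suc zero) zero = ⊤
C4Adj (suc zero) (suc (suc zero)) = ⊤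
C4Adj (suc (suc zero)) (suc zero) = ⊤
C4Adj (suc (suc zero)) (suc (suc (suc zero))) = ⊤
C4Adj (suc (suc (suc zero))) (suc (suc zero)) = ⊤
C4Adj (suc (suc (suc zero))) zero = ⊤
C4Adj zero (suc (suc (suc zero))) = ⊤
C4Adj _ _ = ⊥

C4 : Graph 4
C4 = record { Adj = C4Adj }

-- The sum graph G_M(V) of a finite subset V of a magma M (with its setoid
-- equality ≈).  V is given by an enumeration v : Fin n → Carrier without
-- repetitions (v i ≈ v j → i ≡ j); vertex i stands for v i.
module _ (M : Magma 0ℓ 0ℓ) where
  open Magma M

  InjectiveEnum : {n : ℕ} → (Fin n → Carrier) → Set
  InjectiveEnum v = ∀ i j → v i ≈ v j → i ≡ j

  _∈V_ : {n : ℕ} → Carrier → (Fin n → Carrier) → Set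
  x ∈V v = ∃ λ k → x ≈ v k

  SumAdj : {n : ℕ} → (Fin n → Carrier) → Fin n → Fin n → Set
  SumAdj v i j = i ≢ j × ((v i ∙ v j) ∈V v ⊎ (v j ∙ v i) ∈V v)

  sumGraph : {n : ℕ} → (Fin n → Carrier) → Graph n
  sumGraph v = record { Adj = SumAdj v }

  IsSumGraph : {m : ℕ} → Graph m → Set
  IsSumGraph G = ∃ λ n → ∃ λ (v : Fin n → Carrier) → InjectiveEnum v × (G ≅G sumGraph v)

-- The power set P(S), modelled as characteristic functions S → Bool with
-- extensional (pointwise) equality, and the operation A ⊼ B = S ∖ (A ∩ B).
_⊼_ : {S : Set} → (S → Bool) → (S → Bool) → (S → Bool)
(A ⊼ B) x = not (A x ∧ B x)

PowerNandMagma : (S : Set) → Magma 0ℓ 0ℓ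
PowerNandMagma S = record
  { Carrier = S → Bool
  ; _≈_ = _≗_
  ; _∙_ = _⊼_
  ; isMagma = record
    { isEquivalence = record
      { refl = λ _ → refl
      ; sym = λ p x → sym (p x)
      ; trans = λ p q x → trans (p x) (q x) }
    ; ∙-cong = λ p q x → cong₂ (λ a b → not (a ∧ b)) (p x) (q x) } }

{-# OPTIONS --safe #-}
-- Write the cycle as v₀ v₁ v₂ v₃ and let each edge value vᵢ ⊼ vᵢ₊₁ be one of the
-- four vertices.  It cannot be an endpoint: A ⊼ B = A forces A = S and B = ∅, and
-- then ∅ ⊼ C = S ∈ V for the vertex C opposite B, making a non-edge an edge.  So it
-- is vᵢ₊₂ ("forward") or vᵢ₋₁ ("backward").  A forward edge followed by a backward
-- one gives A ⊼ B = C and B ⊼ C = A, whence A ⊼ C = B puts the non-edge AC in V.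
-- Hence all edges point the same way, and the resulting four equations have no
-- solution at any point of S: then S is empty, so v₀ = v₁, a contradiction.
module Submission where

open import Defs
open import Data.Bool using (Bool; true; false; not; _∧_)
open import Data.Bool.Properties using (∧-comm)
open import Data.Empty using (⊥; ⊥-elim)
open import Data.Fin using (Fin; zero; suc)
open import Data.Nat using (ℕ)
open import Data.Product using (∃; _,_; proj₂)
open import Data.Sum using (inj₁; inj₂)
open import Data.Unit using (tt)
open import Function.Bundles using (Bijection; Equivalence)
open import Relation.Nullary using (¬_)
open import Relation.Binary.PropositionalEquality
  using (_≡_; _≢_; refl; cong; trans; _≗_)

nand-fixˡ : ∀ a b c → not (a ∧ b) ≡ a → not (b ∧ c) ≡ a
nand-fixˡ true  true  c ()
nand-fixˡ true  false c _ = refl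
nand-fixˡ false b     c ()

nand-triangle : ∀ a b {c} → not (a ∧ b) ≡ c → not (b ∧ c) ≡ a → not (a ∧ c) ≡ b
nand-triangle true  true  refl _ = refl
nand-triangle true  false refl _ = refl
nand-triangle false true  refl _ = refl
nand-triangle false false refl ()

nand-4-cycle : ∀ a b {c d} → not (a ∧ b) ≡ c → not (b ∧ c) ≡ d →
               not (c ∧ d) ≡ a → ¬ (not (d ∧ a) ≡ b)
nand-4-cycle true  true  refl refl _  ()
nand-4-cycle true  false refl refl ()
nand-4-cycle false true  refl refl ()
nand-4-cycle false false refl refl _  ()

module _ {S : Set} where

  ⊼-comm : (A B : S → Bool) → A ⊼ B ≗ B ⊼ A
  ⊼-comm A B x = cong not (∧-comm (A x) (B x))

  ⊼-swap : (A B : S → Bool) {C : S → Bool} → A ⊼ B ≗ C → B ⊼ A ≗ C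
  ⊼-swap A B e x = trans (⊼-comm B A x) (e x)

  ⊼-fixˡ : {A B : S → Bool} → A ⊼ B ≗ A → ∀ C → B ⊼ C ≗ A
  ⊼-fixˡ {A} {B} e C x = nand-fixˡ (A x) (B x) (C x) (e x)

  ⊼-triangle : {A B C : S → Bool} → A ⊼ B ≗ C → B ⊼ C ≗ A → A ⊼ C ≗ B
  ⊼-triangle {A} {B} e f x = nand-triangle (A x) (B x) (e x) (f x)

  ⊼-4-cycle : {A B C D : S → Bool} → A ⊼ B ≗ C → B ⊼ C ≗ D → C ⊼ D ≗ A →
              D ⊼ A ≗ B → ¬ S
  ⊼-4-cycle {A} {B} e f g h x = nand-4-cycle (A x) (B x) (e x) (f x) (g x) (h x)

next : Fin 4 → Fin 4
next zero                   = suc zero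
next (suc zero)             = suc (suc zero)
next (suc (suc zero))       = suc (suc (suc zero))
next (suc (suc (suc zero))) = zero

prev : Fin 4 → Fin 4
prev zero                   = suc (suc (suc zero))
prev (suc zero)             = zero
prev (suc (suc zero))       = suc zero
prev (suc (suc (suc zero))) = suc (suc zero)

prev-next : ∀ i → prev (next i) ≡ i
prev-next zero                   = refl
prev-next (suc zero)             = refl
prev-next (suc (suc zero))       = refl
prev-next (suc (suc (suc zero))) = refl

data Position (i : Fin 4) : Fin 4 → Set where
  here     : Position i i
  after    : Position i (next i)
  opposite : Position i (next (next i))
  before   : Position i (prev i)

position : ∀ i z → Position i z
position zero                   zero                   = here
position zero                   (suc zero)             = after
position zero                   (suc (suc zero))       = opposite
position zero                   (suc (suc (suc zero))) = before
position (suc zero)             zero                   = before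
position (suc zero)             (suc zero)             = here
position (suc zero)             (suc (suc zero))       = after
position (suc zero)             (suc (suc (suc zero))) = opposite
position (suc (suc zero))       zero                   = opposite
position (suc (suc zero))       (suc zero)             = before
position (suc (suc zero))       (suc (suc zero))       = here
position (suc (suc zero))       (suc (suc (suc zero))) = after
position (suc (suc (suc zero))) zero                   = after
position (suc (suc (suc zero))) (suc zero)             = opposite
position (suc (suc (suc zero))) (suc (suc zero))       = before
position (suc (suc (suc zero))) (suc (suc (suc zero))) = here

C4-adj-next : ∀ i → C4Adj i (next i)
C4-adj-next zero                   = tt
C4-adj-next (suc zero)             = tt
C4-adj-next (suc (suc zero))       = tt
C4-adj-next (suc (suc (suc zero))) = tt

C4-nonadj-opposite : ∀ i → ¬ C4Adj i (next (next i))
C4-nonadj-opposite zero                   ()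
C4-nonadj-opposite (suc zero)             ()
C4-nonadj-opposite (suc (suc zero))       ()
C4-nonadj-opposite (suc (suc (suc zero))) ()

opposite-≢ : ∀ i → i ≢ next (next i)
opposite-≢ zero                   ()
opposite-≢ (suc zero)             ()
opposite-≢ (suc (suc zero))       ()
opposite-≢ (suc (suc (suc zero))) ()

module C4-NandSumGraph
  (S : Set) {n : ℕ} (v : Fin n → S → Bool)
  (v-injective : InjectiveEnum (PowerNandMagma S) v)
  (iso : C4 ≅G sumGraph (PowerNandMagma S) v) where

  open _≅G_ iso
  open Bijection bij using (injective; strictlySurjective) renaming (to to f)

  V : Fin 4 → S → Bool
  V i = v (f i)

  V-injective : ∀ {i j} → V i ≗ V j → i ≡ j
  V-injective {i} {j} e = injective (v-injective (f i) (f j) e)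

  ∈V⇒vertex : ∀ {X} → _∈V_ (PowerNandMagma S) X v → ∃ λ z → X ≗ V z
  ∈V⇒vertex {X} (k , X≗vk) with strictlySurjective k
  ... | z , refl = z , X≗vk

  edge-value : ∀ i → ∃ λ z → V i ⊼ V (next i) ≗ V z
  edge-value i with proj₂ (Equivalence.to (adj⇔ i (next i)) (C4-adj-next i))
  ... | inj₁ ij∈V = ∈V⇒vertex ij∈V
  ... | inj₂ ji∈V with ∈V⇒vertex ji∈V
  ...   | z , e = z , ⊼-swap (V (next i)) (V i) e

  opposite-value∉V : ∀ i z → ¬ (V i ⊼ V (next (next i)) ≗ V z)
  opposite-value∉V i z e = C4-nonadj-opposite i (Equivalence.from (adj⇔ i (next (next i)))
    ((λ fi≡fj → opposite-≢ i (injective fi≡fj)) , inj₁ (f z , e)))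

  Forward Backward : Fin 4 → Set
  Forward  i = V i ⊼ V (next i) ≗ V (next (next i))
  Backward i = V (next i) ⊼ V i ≗ V (prev i)

  data Orientation (i : Fin 4) : Set where
    forward  : Forward i  → Orientation i
    backward : Backward i → Orientation i

  orientation : ∀ i → Orientation i
  orientation i with edge-value i
  ... | z , e with position i z
  ...   | here     = ⊥-elim (opposite-value∉V (next i) i (⊼-fixˡ e _))
  ...   | after    = ⊥-elim (opposite-value∉V i (next i) (⊼-fixˡ (⊼-swap (V i) (V (next i)) e) _))
  ...   | opposite = forward e
  ...   | before   = backward (⊼-swap (V i) (V (next i)) e)

  forward-then-backward : ∀ i → Forward i → ¬ Backward (next i)
  forward-then-backward i fw bw = opposite-value∉V i (next i)
    (⊼-triangle fw (λ x → trans (⊼-swap (V (next (next i))) (V (next i)) bw x)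
                                (cong (λ j → V j x) (prev-next i))))

  forward-next : ∀ i → Forward i → Forward (next i)
  forward-next i fw with orientation (next i)
  ... | forward fw′  = fw′
  ... | backward bw′ = ⊥-elim (forward-then-backward i fw bw′)

  backward-prev : ∀ i → Backward (next i) → Backward i
  backward-prev i bw with orientation i
  ... | forward fw′  = ⊥-elim (forward-then-backward i fw′ bw)
  ... | backward bw′ = bw′

  S-empty : ¬ S
  S-empty with orientation zero
  ... | forward f₀ = ⊼-4-cycle f₀ f₁ f₂ f₃
    where
    f₁ : Forward (suc zero)
    f₂ : Forward (suc (suc zero))
    f₃ : Forward (suc (suc (suc zero)))
    f₁ = forward-next zero f₀
    f₂ = forward-next (suc zero) f₁
    f₃ = forward-next (suc (suc zero)) f₂
  ... | backward b₀ = ⊼-4-cycle b₀ b₃ b₂ b₁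
    where
    b₃ : Backward (suc (suc (suc zero)))
    b₂ : Backward (suc (suc zero))
    b₁ : Backward (suc zero)
    b₃ = backward-prev (suc (suc (suc zero))) b₀
    b₂ = backward-prev (suc (suc zero)) b₃
    b₁ = backward-prev (suc zero) b₂

  absurd : ⊥
  absurd with V-injective {zero} {suc zero} (λ x → ⊥-elim (S-empty x))
  ... | ()

mainTheorem3 : (S : Set) → ¬ IsSumGraph (PowerNandMagma S) C4
mainTheorem3 S (_ , v , v-injective , iso) = C4-NandSumGraph.absurd S v v-injective iso
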